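{- For $n\ge2$, \[ \frac{1}{n-1}\sum_{k=0}^{n-2}X_{P_k}X_{C_{n-k}}=X_{P_n}. \]
   Context: $P_k$ is the path on $k$ vertices ($P_0$ the empty graph, with $X_{P_0}=1$); $C_m$ is the cycle on $m$ vertices ($C_2$: two vertices joined by an edge). The chromatic symmetric function of a graph $G$ is $X_G=\sum_\kappa\prod_{v\in V(G)}x_{\kappa(v)}$ over proper colorings $\kappa:V(G)\to\{1,2,\dots\}$. -}

module Defs where

open import Data.Bool using (Bool; true; false; T; not; _∧_; _∨_)
open import Data.Nat using (ℕ; zero; suc; _+_; _∸_; _≡ᵇ_)
open import Data.Nat.DivMod using (_%_)
import Data.Nat as ℕ
open import Data.Fin using (Fin; zero; suc; toℕ)
import Data.Fin as F
open import Data.Fin.Properties using (all?)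
open import Data.List using (List; []; _∷_; map; concatMap; filter; length; foldr; upTo; allFin)
open import Data.Vec.Functional using (tail) renaming (_∷_ to _◂_)
open import Data.Integer using (+_)
open import Data.Rational using (ℚ; _/_; 0ℚ) renaming (_+_ to _+ℚ_; _*_ to _*ℚ_)
open import Data.Product using (_×_)
open import Relation.Nullary using (¬_; Dec)
open import Relation.Nullary.Decidable using (_×-dec_; _→-dec_; ¬?)
open import Relation.Binary.PropositionalEquality using (_≡_)

record Graph : Set where
  field
    size : ℕ
    adj  : Fin size → Fin size → Bool
open Graph public

path : ℕ → Graph
path k = record { size = k
                ; adj  = λ i j → ((suc (toℕ i)) ≡ᵇ toℕ j) ∨ ((suc (toℕ j)) ≡ᵇ toℕ i) }

-- Cycle C_m : vertices 0..m-1, i ~ j iff i ≠ j and j ≡ i+1 or i ≡ j+1 (mod m).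
-- (C_2 is a single edge.)
cycle : ℕ → Graph
cycle zero    = record { size = 0 ; adj = λ _ _ → false }
cycle (suc m) = record
  { size = suc m
  ; adj  = λ i j → not (toℕ i ≡ᵇ toℕ j)
                   ∧ (((suc (toℕ i) % suc m) ≡ᵇ toℕ j) ∨ ((suc (toℕ j) % suc m) ≡ᵇ toℕ i)) }

-- A formal power series in x_1, x_2, ... with ℚ coefficients is represented
-- by its coefficient function: for every N and every exponent vector
-- α : Fin N → ℕ, the coefficient of the monomial x_1^{α 0} ... x_N^{α (N-1)}.
-- (Every monomial involves finitely many variables; the same monomial is
-- represented for every larger N by padding α with zeros.)

Series : Set
Series = (N : ℕ) → (Fin N → ℕ) → ℚ

functions : (v N : ℕ) → List (Fin v → Fin N)
functions zero    N = (λ ()) ∷ []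
functions (suc v) N = concatMap (λ c → map (λ f → c ◂ f) (functions v N)) (allFin N)

Proper : (G : Graph) {N : ℕ} → (Fin (size G) → Fin N) → Set
Proper G κ = ∀ i j → T (adj G i j) → ¬ (κ i ≡ κ j)

proper? : (G : Graph) {N : ℕ} (κ : Fin (size G) → Fin N) → Dec (Proper G κ)
proper? G κ = all? λ i → all? λ j → Data.Bool.T? (adj G i j) →-dec ¬? (κ i F.≟ κ j)
  where import Data.Bool

colourCount : {v N : ℕ} → (Fin v → Fin N) → Fin N → ℕ
colourCount {v} κ c = length (filter (λ i → κ i F.≟ c) (allFin v))

HasExponent : {v N : ℕ} → (Fin v → Fin N) → (Fin N → ℕ) → Set
HasExponent κ α = ∀ c → colourCount κ c ≡ α c

hasExponent? : {v N : ℕ} (κ : Fin v → Fin N) (α : Fin N → ℕ) → Dec (HasExponent κ α)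
hasExponent? κ α = all? λ c → colourCount κ c ℕ.≟ α c

X : Graph → Series
X G N α = + length (filter (λ κ → proper? G κ ×-dec hasExponent? κ α)
                           (functions (size G) N)) / 1

sumℚ : List ℚ → ℚ
sumℚ = foldr _+ℚ_ 0ℚ

below : (N : ℕ) → (Fin N → ℕ) → List (Fin N → ℕ)
below zero    α = (λ ()) ∷ []
below (suc N) α = concatMap (λ b → map (λ β → b ◂ β) (below N (tail α))) (upTo (suc (α zero)))

_·_ : Series → Series → Series
(F · G) N α = sumℚ (map (λ β → F N β *ℚ G N (λ i → α i ∸ β i)) (below N α))

_⋆_ : ℚ → Series → Series
(q ⋆ F) N α = q *ℚ F N α

Σ[k≤_]_ : ℕ → (ℕ → Series) → Series
(Σ[k≤ K ] f) N α = sumℚ (map (λ k → f k N α) (upTo (suc K)))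

_≈_ : Series → Series → Set
F ≈ G = ∀ N α → F N α ≡ G N α

-- Proper colourings of P_k are the Smirnov words of length k (no two consecutive letters equal), and
-- those of C_L are the cyclic Smirnov words (in addition, last letter ≠ first letter). So the coefficient
-- of x^α in X_{P_k} X_{C_{n-k}} counts pairs (u , w) of a Smirnov and a cyclic Smirnov word of joint
-- content α, while n - 1 times that of X_{P_n} counts the pairs (s , t), |t| ≥ 2, whose concatenation is
-- a Smirnov word of content α. Over k = 0 … n - 2 the two kinds of pairs are in bijection. For w = a w′:
-- if a occurs in u, cut u at its last a, u = u₁ a u₂, and send (u , w) to (u₁ , a w′ a u₂), which is
-- Smirnov since u₁ a, a w′ a and a u₂ are; otherwise cut a w′ before its last a, a w′ = w₁ a w₂, and send
-- (u , w) to (u w₁ , a w₂), whose concatenation u a w′ is Smirnov since a ∉ u. The inverse tells the two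
-- cases apart by whether a occurs again in t.

module Submission where

open import Defs
open import Data.Nat using (ℕ; suc; _+_; _∸_)
open import Data.Integer using (+_)
open import Data.Rational using (_/_)

open import Data.Bool using (T; not; true; false; _∨_)
open import Data.Bool.Properties using (T-∨; T-∧)
open import Data.Empty using (⊥; ⊥-elim)
open import Data.Fin as Fin using (Fin; zero; suc; toℕ)
open import Data.Fin.Properties using (all?; toℕ<n; toℕ-fromℕ; toℕ-injective)
import Data.Integer as ℤ
import Data.Integer.Properties as ℤ
open import Data.List
  using (List; []; _∷_; _++_; _∷ʳ_; [_]; allFin; map; concatMap; filter; length; upTo; tabulate; cartesianProduct; cartesianProductWith)
open import Data.List.Properties
  using (∷-injective; length-++; filter-++; ++-assoc; upTo-∷ʳ; length-upTo; length-map; map-∘; map-id-local; map-tabulate)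
open import Data.List.Membership.Propositional using (_∈_; _∉_; find; lose)
open import Data.List.Membership.Propositional.Properties
  using ( ∈-filter⁺; ∈-filter⁻; ∈-map⁺; ∈-map⁻; ∈-allFin; ∈-cartesianProductWith⁺; ∈-cartesianProductWith⁻
        ; ∈-cartesianProduct⁺; ∈-cartesianProduct⁻; ∈-concatMap⁺; ∈-concatMap⁻; ∈-upTo⁺; ∈-upTo⁻)
open import Data.List.Membership.Propositional.Properties.WithK using (unique∧set⇒bag)
open import Data.List.Relation.Binary.BagAndSetEquality using (∼bag⇒↭)
open import Data.List.Relation.Binary.Disjoint.Propositional using (Disjoint)
open import Data.List.Relation.Binary.Permutation.Propositional using (_↭_; ↭-refl; ↭-reflexive; ↭-trans; ↭-sym)
import Data.List.Relation.Binary.Permutation.Propositional.Properties as ↭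
import Data.List.Relation.Unary.All as All
import Data.List.Relation.Unary.All.Properties as All
import Data.List.Relation.Unary.AllPairs as AllPairs
import Data.List.Relation.Unary.AllPairs.Properties as AllPairs
open import Data.List.Relation.Unary.Any using (here; there)
open import Data.List.Relation.Unary.Linked using (Linked; []; [-]; _∷_; linked?)
open import Data.List.Relation.Unary.Unique.Propositional using (Unique)
import Data.List.Relation.Unary.Unique.Propositional.Properties as Unique
open import Data.Maybe using (Maybe; just; nothing)
import Data.Maybe as Maybe
open import Data.Nat as ℕ using (zero; _*_; _≤_; _<_; _<?_; z≤n; s≤s)
import Data.Nat.Coprimality as Coprime
open import Data.Nat.DivMod using (_%_; m<n⇒m%n≡m; n%n≡0)
open import Data.Nat.Properties as ℕ
  using (+-assoc; +-identityʳ; *-assoc; *-zeroʳ; *-distribˡ-+; *-distribʳ-+; <-cmp; m<n⇒m<1+n; ≤-pred)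
open import Algebra.Properties.CommutativeSemigroup ℕ.+-commutativeSemigroup using () renaming (interchange to +-interchange)
open import Data.Product using (_×_; _,_; proj₁; proj₂; uncurry)
import Data.Product as Product
open import Data.Product.Function.NonDependent.Propositional using (_×-⇔_)
open import Data.Rational as ℚ using (ℚ; mkℚ; 1/_; 1ℚ)
import Data.Rational.Properties as ℚ
open import Data.Sum using (_⊎_; inj₁; inj₂)
open import Data.Sum.Function.Propositional using (_⊎-⇔_)
open import Data.Vec.Functional using (tail) renaming (_∷_ to _◂_)
open import Function using (_∘_; id; _⇔_; mk⇔; Equivalence)
open import Function.Properties.Equivalence using () renaming (trans to ⇔-trans)
open import Relation.Binary using (DecidableEquality; Tri; tri<; tri≈; tri>)
open import Relation.Binary.PropositionalEquality hiding ([_])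
open import Relation.Nullary using (¬_; ¬?; Dec; yes; no)
open import Relation.Nullary.Decidable using (_×-dec_)
open import Relation.Unary using (Decidable)

private
  variable
    A B C : Set
    P Q : Set
    R : A → A → Set

fromℕ : ℕ → ℚ
fromℕ n = + n / 1

fromℕ≡mkℚ : ∀ n → fromℕ n ≡ mkℚ (+ n) 0 (Coprime.sym (Coprime.1-coprimeTo n))
fromℕ≡mkℚ n = ℚ.normalize-coprime (Coprime.sym (Coprime.1-coprimeTo n))

fromℕ-+ : ∀ a b → fromℕ a ℚ.+ fromℕ b ≡ fromℕ (a + b)
fromℕ-+ a b rewrite fromℕ≡mkℚ a | fromℕ≡mkℚ b =
  ℚ./-cong (cong₂ ℤ._+_ (ℤ.*-identityʳ (+ a)) (ℤ.*-identityʳ (+ b))) refl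

fromℕ-* : ∀ a b → fromℕ a ℚ.* fromℕ b ≡ fromℕ (a * b)
fromℕ-* a b rewrite fromℕ≡mkℚ a | fromℕ≡mkℚ b = ℚ./-cong (sym (ℤ.pos-* a b)) refl

1/suc-*-fromℕ : ∀ m c → (+ 1 / suc m) ℚ.* fromℕ (suc m * c) ≡ fromℕ c
1/suc-*-fromℕ m c = begin
  (+ 1 / suc m) ℚ.* fromℕ (suc m * c)  ≡⟨ cong₂ ℚ._*_ 1/suc≡1/x x*c≡ ⟩
  1/ x ℚ.* (x ℚ.* fromℕ c)             ≡⟨ ℚ.*-assoc (1/ x) x (fromℕ c) ⟨
  (1/ x ℚ.* x) ℚ.* fromℕ c             ≡⟨ cong (ℚ._* fromℕ c) (ℚ.*-inverseˡ x) ⟩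
  1ℚ ℚ.* fromℕ c                       ≡⟨ ℚ.*-identityˡ (fromℕ c) ⟩
  fromℕ c                              ∎
  where
  open ≡-Reasoning
  x : ℚ
  x = mkℚ (+ suc m) 0 (Coprime.sym (Coprime.1-coprimeTo (suc m)))
  1/suc≡1/x : + 1 / suc m ≡ 1/ x
  1/suc≡1/x = ℚ.normalize-coprime (Coprime.1-coprimeTo (suc m))
  x*c≡ : fromℕ (suc m * c) ≡ x ℚ.* fromℕ c
  x*c≡ = trans (sym (fromℕ-* (suc m) c)) (cong (ℚ._* fromℕ c) (fromℕ≡mkℚ (suc m)))

∑ : List A → (A → ℕ) → ℕ
∑ []       f = 0
∑ (x ∷ xs) f = f x + ∑ xs f

syntax ∑ xs (λ x → e) = ∑[ x ∈ xs ] e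

∑-cong : {f g : A → ℕ} (xs : List A) → (∀ {x} → x ∈ xs → f x ≡ g x) → ∑ xs f ≡ ∑ xs g
∑-cong []       f≡g = refl
∑-cong (x ∷ xs) f≡g = cong₂ _+_ (f≡g (here refl)) (∑-cong xs (f≡g ∘ there))

sumℚ-fromℕ : (xs : List A) {F : A → ℚ} {f : A → ℕ} → (∀ {x} → x ∈ xs → F x ≡ fromℕ (f x)) →
             sumℚ (map F xs) ≡ fromℕ (∑ xs f)
sumℚ-fromℕ []       F≡f = refl
sumℚ-fromℕ (x ∷ xs) {f = f} F≡f =
  trans (cong₂ ℚ._+_ (F≡f (here refl)) (sumℚ-fromℕ xs (F≡f ∘ there))) (fromℕ-+ (f x) (∑ xs f))

∑-++ : (xs ys : List A) (f : A → ℕ) → ∑ (xs ++ ys) f ≡ ∑ xs f + ∑ ys f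
∑-++ []       ys f = refl
∑-++ (x ∷ xs) ys f = trans (cong (_+_ (f x)) (∑-++ xs ys f)) (sym (+-assoc (f x) _ _))

∑-+ : (xs : List A) (f g : A → ℕ) → ∑[ x ∈ xs ] (f x + g x) ≡ ∑ xs f + ∑ xs g
∑-+ []       f g = refl
∑-+ (x ∷ xs) f g rewrite ∑-+ xs f g = +-interchange (f x) (g x) (∑ xs f) (∑ xs g)

∑-zero : (xs : List A) → ∑[ x ∈ xs ] 0 ≡ 0
∑-zero []       = refl
∑-zero (x ∷ xs) = ∑-zero xs

∑-const : (xs : List A) (c : ℕ) → ∑[ x ∈ xs ] c ≡ length xs * c
∑-const []       c = refl
∑-const (x ∷ xs) c = cong (_+_ c) (∑-const xs c)

∑-*ˡ : (c : ℕ) (xs : List A) (f : A → ℕ) → ∑[ x ∈ xs ] (c * f x) ≡ c * ∑ xs f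
∑-*ˡ c []       f = sym (*-zeroʳ c)
∑-*ˡ c (x ∷ xs) f = trans (cong (_+_ (c * f x)) (∑-*ˡ c xs f)) (sym (*-distribˡ-+ c (f x) (∑ xs f)))

∑-*ʳ : (c : ℕ) (xs : List A) (f : A → ℕ) → ∑[ x ∈ xs ] (f x * c) ≡ ∑ xs f * c
∑-*ʳ c []       f = refl
∑-*ʳ c (x ∷ xs) f = trans (cong (_+_ (f x * c)) (∑-*ʳ c xs f)) (sym (*-distribʳ-+ c (f x) (∑ xs f)))

∑-map : (g : A → B) (xs : List A) (f : B → ℕ) → ∑ (map g xs) f ≡ ∑ xs (f ∘ g)
∑-map g []       f = refl
∑-map g (x ∷ xs) f = cong (_+_ (f (g x))) (∑-map g xs f)

∑-concatMap : (g : A → List B) (xs : List A) (f : B → ℕ) → ∑ (concatMap g xs) f ≡ ∑[ x ∈ xs ] ∑ (g x) f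
∑-concatMap g []       f = refl
∑-concatMap g (x ∷ xs) f = trans (∑-++ (g x) (concatMap g xs) f) (cong (_+_ (∑ (g x) f)) (∑-concatMap g xs f))

∑-swap : (xs : List A) (ys : List B) (f : A → B → ℕ) → ∑[ x ∈ xs ] ∑[ y ∈ ys ] f x y ≡ ∑[ y ∈ ys ] ∑[ x ∈ xs ] f x y
∑-swap []       ys f = sym (∑-zero ys)
∑-swap (x ∷ xs) ys f = trans (cong (_+_ (∑ ys (f x))) (∑-swap xs ys f)) (sym (∑-+ ys (f x) _))

∑-cartesianProductWith : (g : A → B → C) (xs : List A) (ys : List B) (f : C → ℕ) →
                         ∑ (cartesianProductWith g xs ys) f ≡ ∑[ x ∈ xs ] ∑[ y ∈ ys ] f (g x y)
∑-cartesianProductWith g []       ys f = refl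
∑-cartesianProductWith g (x ∷ xs) ys f =
  trans (∑-++ (map (g x) ys) _ f) (cong₂ _+_ (∑-map (g x) ys f) (∑-cartesianProductWith g xs ys f))

∑*∑ : (xs : List A) (ys : List B) (f : A → ℕ) (g : B → ℕ) →
      ∑ xs f * ∑ ys g ≡ ∑[ p ∈ cartesianProduct xs ys ] (f (proj₁ p) * g (proj₂ p))
∑*∑ xs ys f g = begin
  ∑ xs f * ∑ ys g                    ≡⟨ ∑-*ʳ (∑ ys g) xs f ⟨
  ∑[ x ∈ xs ] (f x * ∑ ys g)         ≡⟨ ∑-cong xs (λ {x} _ → ∑-*ˡ (f x) ys g) ⟨
  ∑[ x ∈ xs ] ∑[ y ∈ ys ] (f x * g y) ≡⟨ ∑-cartesianProductWith _,_ xs ys _ ⟨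
  ∑[ p ∈ cartesianProduct xs ys ] (f (proj₁ p) * g (proj₂ p)) ∎
  where open ≡-Reasoning

𝟙 : {P : Set} → Dec P → ℕ
𝟙 (yes _) = 1
𝟙 (no _)  = 0

𝟙-yes : (p? : Dec P) → P → 𝟙 p? ≡ 1
𝟙-yes (yes _) _ = refl
𝟙-yes (no ¬p) p = ⊥-elim (¬p p)

𝟙-no : (p? : Dec P) → ¬ P → 𝟙 p? ≡ 0
𝟙-no (yes p) ¬p = ⊥-elim (¬p p)
𝟙-no (no _)  _  = refl

𝟙-cong : (p? : Dec P) (q? : Dec Q) → P ⇔ Q → 𝟙 p? ≡ 𝟙 q?
𝟙-cong (yes p) q? P⇔Q = sym (𝟙-yes q? (Equivalence.to P⇔Q p))
𝟙-cong (no ¬p) q? P⇔Q = sym (𝟙-no q? (¬p ∘ Equivalence.from P⇔Q))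

𝟙-× : (p? : Dec P) (q? : Dec Q) → 𝟙 (p? ×-dec q?) ≡ 𝟙 p? * 𝟙 q?
𝟙-× (yes _) (yes _) = refl
𝟙-× (yes _) (no _)  = refl
𝟙-× (no _)  _       = refl

length-filter≡∑𝟙 : {P : A → Set} (P? : Decidable P) (xs : List A) → length (filter P? xs) ≡ ∑[ x ∈ xs ] 𝟙 (P? x)
length-filter≡∑𝟙 P? []       = refl
length-filter≡∑𝟙 P? (x ∷ xs) with P? x
... | yes _ = cong suc (length-filter≡∑𝟙 P? xs)
... | no _  = length-filter≡∑𝟙 P? xs

∑𝟙-bijection : {P Q : A → Set} (P? : Decidable P) (Q? : Decidable Q) {xs : List A} → Unique xs → (f g : A → A) →
               (∀ {x} → x ∈ xs → P x → f x ∈ xs × Q (f x) × g (f x) ≡ x) →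
               (∀ {y} → y ∈ xs → Q y → g y ∈ xs × P (g y) × f (g y) ≡ y) →
               ∑[ x ∈ xs ] 𝟙 (P? x) ≡ ∑[ x ∈ xs ] 𝟙 (Q? x)
∑𝟙-bijection P? Q? {xs} xs! f g f-correct g-correct = begin
  ∑[ x ∈ xs ] 𝟙 (P? x)          ≡⟨ length-filter≡∑𝟙 P? xs ⟨
  length (filter P? xs)         ≡⟨ length-map f (filter P? xs) ⟨
  length (map f (filter P? xs)) ≡⟨ ↭.↭-length (∼bag⇒↭ (unique∧set⇒bag fPs! Qs! (mk⇔ fPs⊆Qs Qs⊆fPs))) ⟩
  length (filter Q? xs)         ≡⟨ length-filter≡∑𝟙 Q? xs ⟩
  ∑[ x ∈ xs ] 𝟙 (Q? x)          ∎
  where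
  open ≡-Reasoning
  g∘f≗id : map g (map f (filter P? xs)) ≡ filter P? xs
  g∘f≗id = trans (sym (map-∘ (filter P? xs))) (map-id-local (All.tabulate λ x∈ →
    let x∈xs , Px = ∈-filter⁻ P? x∈ in proj₂ (proj₂ (f-correct x∈xs Px))))
  Qs! : Unique (filter Q? xs)
  Qs! = Unique.filter⁺ Q? xs!
  fPs! : Unique (map f (filter P? xs))
  fPs! = Unique.map⁻ (subst Unique (sym g∘f≗id) (Unique.filter⁺ P? xs!))
  fPs⊆Qs : ∀ {y} → y ∈ map f (filter P? xs) → y ∈ filter Q? xs
  fPs⊆Qs y∈ with ∈-map⁻ f y∈
  ... | x , x∈ , refl = let x∈xs , Px = ∈-filter⁻ P? x∈ ; fx∈xs , Qfx , _ = f-correct x∈xs Px in ∈-filter⁺ Q? fx∈xs Qfx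
  Qs⊆fPs : ∀ {y} → y ∈ filter Q? xs → y ∈ map f (filter P? xs)
  Qs⊆fPs y∈ = let y∈xs , Qy = ∈-filter⁻ Q? y∈ ; gy∈xs , Pgy , fgy≡y = g-correct y∈xs Qy in
    subst (_∈ map f (filter P? xs)) fgy≡y (∈-map⁺ f (∈-filter⁺ P? gy∈xs Pgy))

∑-upTo-sift : (g K : ℕ) (h : ℕ → ℕ) → ∑[ b ∈ upTo K ] (𝟙 (g ℕ.≟ b) * h b) ≡ 𝟙 (g <? K) * h g
∑-upTo-sift g zero    h = refl
∑-upTo-sift g (suc K) h = begin
  ∑ (upTo (suc K)) f                          ≡⟨ cong (λ bs → ∑ bs f) (upTo-∷ʳ K) ⟨
  ∑ (upTo K ∷ʳ K) f                           ≡⟨ ∑-++ (upTo K) [ K ] f ⟩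
  ∑ (upTo K) f + (f K + 0)                    ≡⟨ cong (_+ (f K + 0)) (∑-upTo-sift g K h) ⟩
  𝟙 (g <? K) * h g + (f K + 0)                ≡⟨ extend (<-cmp g K) ⟩
  𝟙 (g <? suc K) * h g                        ∎
  where
  open ≡-Reasoning
  f : ℕ → ℕ
  f b = 𝟙 (g ℕ.≟ b) * h b
  extend : Tri (g < K) (g ≡ K) (K < g) → 𝟙 (g <? K) * h g + (f K + 0) ≡ 𝟙 (g <? suc K) * h g
  extend (tri< g<K g≢K _)
    rewrite 𝟙-yes (g <? K) g<K | 𝟙-no (g ℕ.≟ K) g≢K | 𝟙-yes (g <? suc K) (m<n⇒m<1+n g<K) = +-identityʳ _
  extend (tri≈ g≮K refl _)
    rewrite 𝟙-no (g <? K) g≮K | 𝟙-yes (g ℕ.≟ K) refl | 𝟙-yes (g <? suc K) (ℕ.n<1+n K) = +-identityʳ _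
  extend (tri> g≮K g≢K K<g)
    rewrite 𝟙-no (g <? K) g≮K | 𝟙-no (g ℕ.≟ K) g≢K | 𝟙-no (g <? suc K) (ℕ.<⇒≱ K<g ∘ ≤-pred) = refl

_≗?_ : {N : ℕ} (γ δ : Fin N → ℕ) → Dec (γ ≗ δ)
γ ≗? δ = all? λ i → γ i ℕ.≟ δ i

𝟙-≗?-◂ : {N : ℕ} (γ δ : Fin (suc N) → ℕ) → 𝟙 (γ ≗? δ) ≡ 𝟙 (γ zero ℕ.≟ δ zero) * 𝟙 (tail γ ≗? tail δ)
𝟙-≗?-◂ γ δ = trans (𝟙-cong (γ ≗? δ) (γ zero ℕ.≟ δ zero ×-dec tail γ ≗? tail δ) split)
                   (𝟙-× (γ zero ℕ.≟ δ zero) (tail γ ≗? tail δ))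
  where
  split : γ ≗ δ ⇔ (γ zero ≡ δ zero × tail γ ≗ tail δ)
  split = mk⇔ (λ γ≗δ → γ≗δ zero , γ≗δ ∘ suc) λ { (≡₀ , _) zero → ≡₀ ; (_ , ≗₊) (suc i) → ≗₊ i }

𝟙-≤×≡∸ : (g d a : ℕ) → 𝟙 (g <? suc a) * 𝟙 (d ℕ.≟ a ∸ g) ≡ 𝟙 (g + d ℕ.≟ a)
𝟙-≤×≡∸ g d a = trans (sym (𝟙-× (g <? suc a) (d ℕ.≟ a ∸ g))) (𝟙-cong _ (g + d ℕ.≟ a) (mk⇔ to from))
  where
  to : g < suc a × d ≡ a ∸ g → g + d ≡ a
  to (g<1+a , refl) = ℕ.m+[n∸m]≡n (≤-pred g<1+a)
  from : g + d ≡ a → g < suc a × d ≡ a ∸ g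
  from refl = s≤s (ℕ.m≤m+n g d) , sym (ℕ.m+n∸m≡n g d)

∑-below-𝟙 : (N : ℕ) (α γ δ : Fin N → ℕ) →
            ∑[ β ∈ below N α ] (𝟙 (γ ≗? β) * 𝟙 (δ ≗? (λ i → α i ∸ β i))) ≡ 𝟙 ((λ i → γ i + δ i) ≗? α)
∑-below-𝟙 zero    α γ δ = refl
∑-below-𝟙 (suc N) α γ δ = begin
  ∑ (below (suc N) α) f
    ≡⟨ ∑-concatMap (λ b → map (b ◂_) (below N (tail α))) (upTo (suc (α zero))) f ⟩
  ∑[ b ∈ upTo (suc (α zero)) ] ∑ (map (b ◂_) (below N (tail α))) f
    ≡⟨ ∑-cong (upTo (suc (α zero))) (λ {b} _ → ∑-map (b ◂_) (below N (tail α)) f) ⟩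
  ∑[ b ∈ upTo (suc (α zero)) ] ∑[ β ∈ below N (tail α) ] f (b ◂ β)
    ≡⟨ ∑-cong (upTo (suc (α zero))) (λ {b} _ → inner b) ⟩
  ∑[ b ∈ upTo (suc (α zero)) ] (𝟙 (γ zero ℕ.≟ b) * (𝟙 (δ zero ℕ.≟ α zero ∸ b) * rest))
    ≡⟨ ∑-upTo-sift (γ zero) (suc (α zero)) (λ b → 𝟙 (δ zero ℕ.≟ α zero ∸ b) * rest) ⟩
  𝟙 (γ zero <? suc (α zero)) * (𝟙 (δ zero ℕ.≟ α zero ∸ γ zero) * rest)
    ≡⟨ *-assoc (𝟙 (γ zero <? suc (α zero))) _ rest ⟨
  𝟙 (γ zero <? suc (α zero)) * 𝟙 (δ zero ℕ.≟ α zero ∸ γ zero) * rest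
    ≡⟨ cong (_* rest) (𝟙-≤×≡∸ (γ zero) (δ zero) (α zero)) ⟩
  𝟙 (γ zero + δ zero ℕ.≟ α zero) * rest
    ≡⟨ 𝟙-≗?-◂ (λ i → γ i + δ i) α ⟨
  𝟙 ((λ i → γ i + δ i) ≗? α) ∎
  where
  open ≡-Reasoning
  f : (Fin (suc N) → ℕ) → ℕ
  f β = 𝟙 (γ ≗? β) * 𝟙 (δ ≗? (λ i → α i ∸ β i))
  rest : ℕ
  rest = 𝟙 ((λ i → tail γ i + tail δ i) ≗? tail α)
  inner : ∀ b → ∑[ β ∈ below N (tail α) ] f (b ◂ β) ≡ 𝟙 (γ zero ℕ.≟ b) * (𝟙 (δ zero ℕ.≟ α zero ∸ b) * rest)
  inner b = begin
    ∑[ β ∈ below N (tail α) ] f (b ◂ β)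
      ≡⟨ ∑-cong (below N (tail α)) (λ {β} _ → cong₂ _*_ (𝟙-≗?-◂ γ (b ◂ β)) (𝟙-≗?-◂ δ _)) ⟩
    ∑[ β ∈ below N (tail α) ] ((h₀ * 𝟙 (tail γ ≗? β)) * (h₁ * 𝟙 (tail δ ≗? (λ i → tail α i ∸ β i))))
      ≡⟨ ∑-cong (below N (tail α)) (λ _ → ℕ.[m*n]*[o*p]≡[m*o]*[n*p] h₀ _ h₁ _) ⟩
    ∑[ β ∈ below N (tail α) ] ((h₀ * h₁) * (𝟙 (tail γ ≗? β) * 𝟙 (tail δ ≗? (λ i → tail α i ∸ β i))))
      ≡⟨ ∑-*ˡ (h₀ * h₁) (below N (tail α)) _ ⟩
    (h₀ * h₁) * ∑[ β ∈ below N (tail α) ] (𝟙 (tail γ ≗? β) * 𝟙 (tail δ ≗? (λ i → tail α i ∸ β i)))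
      ≡⟨ cong ((h₀ * h₁) *_) (∑-below-𝟙 N (tail α) (tail γ) (tail δ)) ⟩
    (h₀ * h₁) * rest
      ≡⟨ *-assoc h₀ h₁ rest ⟩
    h₀ * (h₁ * rest) ∎
    where
    h₀ h₁ : ℕ
    h₀ = 𝟙 (γ zero ℕ.≟ b)
    h₁ = 𝟙 (δ zero ℕ.≟ α zero ∸ b)

∉-∷ : ∀ {a x} {xs : List A} → a ≢ x → a ∉ xs → a ∉ x ∷ xs
∉-∷ a≢x a∉xs (here a≡x)   = a≢x a≡x
∉-∷ a≢x a∉xs (there a∈xs) = a∉xs a∈xs

Linked-++⁻ˡ : ∀ xs {ys : List A} → Linked R (xs ++ ys) → Linked R xs
Linked-++⁻ˡ []           _       = []
Linked-++⁻ˡ (x ∷ [])     _       = [-]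
Linked-++⁻ˡ (x ∷ y ∷ xs) (r ∷ l) = r ∷ Linked-++⁻ˡ (y ∷ xs) l

Linked-++-∷⁻ : ∀ xs {a} {ys : List A} → Linked R (xs ++ a ∷ ys) → Linked R (xs ∷ʳ a) × Linked R (a ∷ ys)
Linked-++-∷⁻ []           l       = [-] , l
Linked-++-∷⁻ (x ∷ [])     (r ∷ l) = r ∷ [-] , l
Linked-++-∷⁻ (x ∷ y ∷ xs) (r ∷ l) = Product.map₁ (r ∷_) (Linked-++-∷⁻ (y ∷ xs) l)

Linked-++-∷⁺ : ∀ xs {a} {ys : List A} → Linked R (xs ∷ʳ a) → Linked R (a ∷ ys) → Linked R (xs ++ a ∷ ys)
Linked-++-∷⁺ []           _        l = l
Linked-++-∷⁺ (x ∷ [])     (r ∷ _)  l = r ∷ l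
Linked-++-∷⁺ (x ∷ y ∷ xs) (r ∷ l′) l = r ∷ Linked-++-∷⁺ (y ∷ xs) l′ l

Smirnov : List A → Set
Smirnov = Linked _≢_

CyclicSmirnov : List A → Set
CyclicSmirnov []      = ⊥
CyclicSmirnov (a ∷ w) = Smirnov ((a ∷ w) ∷ʳ a)

smirnov? : DecidableEquality A → Decidable (Smirnov {A})
smirnov? _≟_ = linked? λ x y → ¬? (x ≟ y)

cyclicSmirnov? : DecidableEquality A → Decidable (CyclicSmirnov {A})
cyclicSmirnov? _≟_ []      = no λ ()
cyclicSmirnov? _≟_ (a ∷ w) = smirnov? _≟_ ((a ∷ w) ∷ʳ a)

Smirnov-∷ʳ : ∀ {xs} {a : A} → Smirnov xs → a ∉ xs → Smirnov (xs ∷ʳ a)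
Smirnov-∷ʳ []      a∉ = [-]
Smirnov-∷ʳ [-]     a∉ = (λ x≡a → a∉ (here (sym x≡a))) ∷ [-]
Smirnov-∷ʳ (r ∷ l) a∉ = r ∷ Smirnov-∷ʳ l (a∉ ∘ there)

CyclicSmirnov⇒2≤length : (w : List A) → CyclicSmirnov w → 2 ≤ length w
CyclicSmirnov⇒2≤length (a ∷ [])    (a≢a ∷ _) = ⊥-elim (a≢a refl)
CyclicSmirnov⇒2≤length (a ∷ b ∷ w) _         = s≤s (s≤s z≤n)

Smirnov-++-∉ : ∀ u {a : A} {w} → a ∉ u → Smirnov u → Smirnov (a ∷ w) → Smirnov (u ++ a ∷ w)
Smirnov-++-∉ u a∉u σu σaw = Linked-++-∷⁺ u (Smirnov-∷ʳ σu a∉u) σaw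

Smirnov⇒CyclicSmirnov : ∀ {a : A} {t} → Smirnov (a ∷ t) → a ∉ t → 2 ≤ length (a ∷ t) → CyclicSmirnov (a ∷ t)
Smirnov⇒CyclicSmirnov {t = []}    _       _   (s≤s ())
Smirnov⇒CyclicSmirnov {t = _ ∷ _} (r ∷ σ) a∉t _ = r ∷ Smirnov-∷ʳ σ a∉t

2≤2+m∸k : ∀ {k m} → k ≤ m → 2 ≤ 2 + m ∸ k
2≤2+m∸k k≤m = subst (2 ≤_) (sym (ℕ.+-∸-assoc 2 k≤m)) (s≤s (s≤s z≤n))

2≤length-∷-++-∷ : ∀ {a b : A} w {v} → 2 ≤ length (a ∷ w ++ b ∷ v)
2≤length-∷-++-∷ []      = s≤s (s≤s z≤n)
2≤length-∷-++-∷ (_ ∷ _) = s≤s (s≤s z≤n)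

module CycleInsertion {A : Set} (_≟_ : DecidableEquality A) where

  splitFirst : A → List A → Maybe (List A × List A)
  splitFirst a []       = nothing
  splitFirst a (x ∷ xs) with x ≟ a
  ... | yes _ = just ([] , xs)
  ... | no _  = Maybe.map (Product.map₁ (x ∷_)) (splitFirst a xs)

  splitLast : A → List A → Maybe (List A × List A)
  splitLast a []       = nothing
  splitLast a (x ∷ xs) with splitLast a xs | x ≟ a
  ... | just (p , q) | _     = just (x ∷ p , q)
  ... | nothing      | yes _ = just ([] , xs)
  ... | nothing      | no _  = nothing

  splitFirst-∉ : ∀ {a} xs → a ∉ xs → splitFirst a xs ≡ nothing
  splitFirst-∉ []       a∉ = refl
  splitFirst-∉ {a} (x ∷ xs) a∉ with x ≟ a
  ... | yes refl = ⊥-elim (a∉ (here refl))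
  ... | no _     = cong (Maybe.map _) (splitFirst-∉ xs (a∉ ∘ there))

  splitFirst-++-∷ : ∀ {a} p q → a ∉ p → splitFirst a (p ++ a ∷ q) ≡ just (p , q)
  splitFirst-++-∷ {a} []      q a∉ with a ≟ a
  ... | yes _   = refl
  ... | no a≢a  = ⊥-elim (a≢a refl)
  splitFirst-++-∷ {a} (x ∷ p) q a∉ with x ≟ a
  ... | yes refl = ⊥-elim (a∉ (here refl))
  ... | no _     = cong (Maybe.map _) (splitFirst-++-∷ p q (a∉ ∘ there))

  splitLast-∉ : ∀ {a} xs → a ∉ xs → splitLast a xs ≡ nothing
  splitLast-∉ []       a∉ = refl
  splitLast-∉ {a} (x ∷ xs) a∉ rewrite splitLast-∉ xs (a∉ ∘ there) with x ≟ a
  ... | yes refl = ⊥-elim (a∉ (here refl))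
  ... | no _     = refl

  splitLast-++-∷ : ∀ {a} p q → a ∉ q → splitLast a (p ++ a ∷ q) ≡ just (p , q)
  splitLast-++-∷ {a} []      q a∉ rewrite splitLast-∉ _ a∉ with a ≟ a
  ... | yes _  = refl
  ... | no a≢a = ⊥-elim (a≢a refl)
  splitLast-++-∷ (x ∷ p) q a∉ rewrite splitLast-++-∷ p q a∉ = refl

  data FirstOccurrence (a : A) : List A → Set where
    first  : ∀ p q → a ∉ p → FirstOccurrence a (p ++ a ∷ q)
    absent : ∀ {xs} → a ∉ xs → FirstOccurrence a xs

  firstOccurrence : ∀ a xs → FirstOccurrence a xs
  firstOccurrence a []       = absent λ ()
  firstOccurrence a (x ∷ xs) with x ≟ a | firstOccurrence a xs
  ... | yes refl | _              = first [] xs λ ()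
  ... | no x≢a   | first p q a∉p  = first (x ∷ p) q (∉-∷ (x≢a ∘ sym) a∉p)
  ... | no x≢a   | absent a∉xs    = absent (∉-∷ (x≢a ∘ sym) a∉xs)

  data LastOccurrence (a : A) : List A → Set where
    last   : ∀ p q → a ∉ q → LastOccurrence a (p ++ a ∷ q)
    absent : ∀ {xs} → a ∉ xs → LastOccurrence a xs

  lastOccurrence : ∀ a xs → LastOccurrence a xs
  lastOccurrence a []       = absent λ ()
  lastOccurrence a (x ∷ xs) with lastOccurrence a xs | x ≟ a
  ... | last p q a∉q | _        = last (x ∷ p) q a∉q
  ... | absent a∉xs  | yes refl = last [] xs a∉xs
  ... | absent a∉xs  | no x≢a   = absent (∉-∷ (x≢a ∘ sym) a∉xs)

  insertCycle : List A × List A → List A × List A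
  insertCycle (u , [])    = u , []
  insertCycle (u , a ∷ w) = insert (splitLast a u) (splitLast a w)
    where
    insert : Maybe (List A × List A) → Maybe (List A × List A) → List A × List A
    insert (just (u₁ , u₂)) _                = u₁ , a ∷ w ++ a ∷ u₂
    insert nothing          (just (w₁ , w₂)) = u ++ a ∷ w₁ , a ∷ w₂
    insert nothing          nothing          = u , a ∷ w

  extractCycle : List A × List A → List A × List A
  extractCycle (s , [])    = s , []
  extractCycle (s , a ∷ t) = extract (splitLast a t) (splitFirst a s)
    where
    extract : Maybe (List A × List A) → Maybe (List A × List A) → List A × List A
    extract (just (x , y)) _              = s ++ a ∷ y , a ∷ x
    extract nothing        (just (p , q)) = p , a ∷ q ++ a ∷ t
    extract nothing        nothing        = s , a ∷ t

  PathCycle : List A × List A → Set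
  PathCycle p = Smirnov (proj₁ p) × CyclicSmirnov (proj₂ p)

  SplitSmirnov : List A × List A → Set
  SplitSmirnov p = Smirnov (uncurry _++_ p) × 2 ≤ length (proj₂ p)

  insertCycle-↭ : ∀ p → uncurry _++_ (insertCycle p) ↭ uncurry _++_ p
  insertCycle-↭ (u , [])    = ↭-refl
  insertCycle-↭ (u , a ∷ w) with lastOccurrence a u
  ... | last u₁ u₂ a∉u₂ rewrite splitLast-++-∷ u₁ u₂ a∉u₂ = ↭-trans
    (↭.++⁺ˡ u₁ (↭.++-comm (a ∷ w) (a ∷ u₂))) (↭-reflexive (sym (++-assoc u₁ (a ∷ u₂) (a ∷ w))))
  ... | absent a∉u rewrite splitLast-∉ u a∉u with lastOccurrence a w
  ...   | last w₁ w₂ a∉w₂ rewrite splitLast-++-∷ w₁ w₂ a∉w₂ = ↭-reflexive (++-assoc u (a ∷ w₁) (a ∷ w₂))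
  ...   | absent a∉w rewrite splitLast-∉ w a∉w = ↭-refl

  insertCycle-correct : ∀ p → PathCycle p → SplitSmirnov (insertCycle p) × extractCycle (insertCycle p) ≡ p
  insertCycle-correct (u , a ∷ w) (σu , σw) with lastOccurrence a u
  ... | last u₁ u₂ a∉u₂ rewrite splitLast-++-∷ u₁ u₂ a∉u₂ | splitLast-++-∷ w u₂ a∉u₂ =
    let σu₁a , σau₂ = Linked-++-∷⁻ u₁ σu in
    (Linked-++-∷⁺ u₁ σu₁a (Linked-++-∷⁺ (a ∷ w) σw σau₂) , 2≤length-∷-++-∷ {a = a} w) , refl
  ... | absent a∉u rewrite splitLast-∉ u a∉u with lastOccurrence a w
  ...   | last w₁ w₂ a∉w₂ rewrite splitLast-++-∷ w₁ w₂ a∉w₂ | splitLast-∉ w₂ a∉w₂ | splitFirst-++-∷ u w₁ a∉u =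
    let σaw₂ = proj₂ (Linked-++-∷⁻ (a ∷ w₁) (subst (λ v → Smirnov (a ∷ v)) (++-assoc w₁ (a ∷ w₂) [ a ]) σw)) in
    (subst Smirnov (sym (++-assoc u (a ∷ w₁) (a ∷ w₂))) (Smirnov-++-∉ u a∉u σu (Linked-++⁻ˡ (a ∷ w) σw)) ,
     CyclicSmirnov⇒2≤length (a ∷ w₂) σaw₂) , refl
  -- splitLast a w is rewritten twice: the second occurrence appears only once insertCycle has reduced.
  ...   | absent a∉w rewrite splitLast-∉ w a∉w | splitFirst-∉ u a∉u | splitLast-∉ w a∉w =
    (Smirnov-++-∉ u a∉u σu (Linked-++⁻ˡ (a ∷ w) σw) , CyclicSmirnov⇒2≤length (a ∷ w) σw) , refl
  extractCycle-correct : ∀ p → SplitSmirnov p → PathCycle (extractCycle p) × insertCycle (extractCycle p) ≡ p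
  extractCycle-correct (s , a ∷ t) (σ , 2≤) with lastOccurrence a t
  ... | last x y a∉y rewrite splitLast-++-∷ x y a∉y | splitLast-++-∷ s y a∉y =
    let σsa , σaxay = Linked-++-∷⁻ s σ ; σax , σay = Linked-++-∷⁻ (a ∷ x) σaxay in
    (Linked-++-∷⁺ s σsa σay , σax) , refl
  ... | absent a∉t rewrite splitLast-∉ t a∉t with firstOccurrence a s
  ...   | first p q a∉p rewrite splitFirst-++-∷ p q a∉p | splitLast-∉ p a∉p | splitLast-++-∷ q t a∉t =
    let σpa , σaqat = Linked-++-∷⁻ p (subst Smirnov (++-assoc p (a ∷ q) (a ∷ t)) σ)
        σaqa , σat  = Linked-++-∷⁻ (a ∷ q) σaqat
        σcycle      = Linked-++-∷⁺ (a ∷ q) σaqa (Smirnov⇒CyclicSmirnov σat a∉t 2≤)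
    in (Linked-++⁻ˡ p σpa , subst (λ v → Smirnov (a ∷ v)) (sym (++-assoc q (a ∷ t) [ a ])) σcycle) , refl
  ...   | absent a∉s rewrite splitFirst-∉ s a∉s | splitLast-∉ s a∉s | splitLast-∉ t a∉t =
    (Linked-++⁻ˡ s σ , Smirnov⇒CyclicSmirnov (proj₂ (Linked-++-∷⁻ s σ)) a∉t 2≤) , refl

  extractCycle-↭ : ∀ p → SplitSmirnov p → uncurry _++_ (extractCycle p) ↭ uncurry _++_ p
  extractCycle-↭ p split = ↭-trans (↭-sym (insertCycle-↭ (extractCycle p)))
                                   (↭-reflexive (cong (uncurry _++_) (proj₂ (extractCycle-correct p split))))

Linked-tabulate⁺ : ∀ {v} (f : Fin v → A) → (∀ i j → suc (toℕ i) ≡ toℕ j → R (f i) (f j)) → Linked R (tabulate f)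
Linked-tabulate⁺ {v = zero}        f h = []
Linked-tabulate⁺ {v = suc zero}    f h = [-]
Linked-tabulate⁺ {v = suc (suc v)} f h =
  h zero (suc zero) refl ∷ Linked-tabulate⁺ (f ∘ suc) (λ i j e → h (suc i) (suc j) (cong suc e))

Linked-tabulate⁻ : ∀ {v} (f : Fin v → A) → Linked R (tabulate f) → ∀ i j → suc (toℕ i) ≡ toℕ j → R (f i) (f j)
Linked-tabulate⁻ {v = suc zero}    f _       zero    zero       ()
Linked-tabulate⁻ {v = suc (suc v)} f (r ∷ _) zero    (suc zero) refl = r
Linked-tabulate⁻ {v = suc (suc v)} f (_ ∷ l) (suc i) (suc j)    e    = Linked-tabulate⁻ (f ∘ suc) l i j (ℕ.suc-injective e)

Linked-tabulate-∷ʳ⁺ : ∀ {v} (f : Fin (suc v) → A) {a} →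
                      Linked R (tabulate f) → R (f (Fin.fromℕ v)) a → Linked R (tabulate f ∷ʳ a)
Linked-tabulate-∷ʳ⁺ {v = zero}  f [-]      r = r ∷ [-]
Linked-tabulate-∷ʳ⁺ {v = suc v} f (r′ ∷ l) r = r′ ∷ Linked-tabulate-∷ʳ⁺ (f ∘ suc) l r

Linked-tabulate-∷ʳ⁻ : ∀ {v} (f : Fin (suc v) → A) {a} →
                      Linked R (tabulate f ∷ʳ a) → Linked R (tabulate f) × R (f (Fin.fromℕ v)) a
Linked-tabulate-∷ʳ⁻ {v = zero}  f (r ∷ _)  = [-] , r
Linked-tabulate-∷ʳ⁻ {v = suc v} f (r′ ∷ l) = Product.map₁ (r′ ∷_) (Linked-tabulate-∷ʳ⁻ (f ∘ suc) l)

Proper⇔oriented : (G : Graph) (S : Fin (size G) → Fin (size G) → Set) → (∀ i j → T (adj G i j) ⇔ (S i j ⊎ S j i)) →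
                  {N : ℕ} (κ : Fin (size G) → Fin N) → Proper G κ ⇔ (∀ i j → S i j → κ i ≢ κ j)
Proper⇔oriented G S adj⇔ κ = mk⇔ to from
  where
  to : Proper G κ → ∀ i j → S i j → κ i ≢ κ j
  to proper i j s = proper i j (Equivalence.from (adj⇔ i j) (inj₁ s))
  from : (∀ i j → S i j → κ i ≢ κ j) → Proper G κ
  from h i j a with Equivalence.to (adj⇔ i j) a
  ... | inj₁ s = h i j s
  ... | inj₂ s = h j i s ∘ sym

T-≡ᵇ : ∀ {m n} → T (m ℕ.≡ᵇ n) ⇔ m ≡ n
T-≡ᵇ = mk⇔ (ℕ.≡ᵇ⇒≡ _ _) (ℕ.≡⇒≡ᵇ _ _)

T-not : ∀ {b} → ¬ T b → T (not b)
T-not {false} _  = _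
T-not {true}  ¬t = ¬t _

path-adj : ∀ {v} (i j : Fin v) → T (adj (path v) i j) ⇔ (suc (toℕ i) ≡ toℕ j ⊎ suc (toℕ j) ≡ toℕ i)
path-adj i j = ⇔-trans T-∨ (T-≡ᵇ ⊎-⇔ T-≡ᵇ)

Proper-path⇔Smirnov : ∀ {v N} (κ : Fin v → Fin N) → Proper (path v) κ ⇔ Smirnov (tabulate κ)
Proper-path⇔Smirnov κ = ⇔-trans (Proper⇔oriented (path _) _ path-adj κ) (mk⇔ (Linked-tabulate⁺ κ) (Linked-tabulate⁻ κ))

suc-toℕ<⊎≡last : ∀ {n} (i : Fin (suc n)) → suc (toℕ i) < suc n ⊎ toℕ i ≡ n
suc-toℕ<⊎≡last {n} i with suc (toℕ i) <? suc n
... | yes lt = inj₁ lt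
... | no ¬lt = inj₂ (ℕ.≤-antisym (≤-pred (toℕ<n i)) (≤-pred (ℕ.≮⇒≥ ¬lt)))

module _ (l : ℕ) where

  private
    L : ℕ
    L = suc (suc l)

  suc-toℕ%≢toℕ : (i : Fin L) → suc (toℕ i) % L ≢ toℕ i
  suc-toℕ%≢toℕ i with suc-toℕ<⊎≡last i
  ... | inj₁ lt   = ℕ.1+n≢n ∘ trans (sym (m<n⇒m%n≡m lt))
  ... | inj₂ i≡last rewrite i≡last = ℕ.0≢1+n ∘ trans (sym (n%n≡0 L))

  cycle-adj : (i j : Fin L) → T (adj (cycle L) i j) ⇔ (suc (toℕ i) % L ≡ toℕ j ⊎ suc (toℕ j) % L ≡ toℕ i)
  cycle-adj i j = mk⇔ (Equivalence.to succ⇔ ∘ proj₂ ∘ Equivalence.to T-∧)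
                      (λ s → Equivalence.from T-∧
                               (T-not (distinct s ∘ ℕ.≡ᵇ⇒≡ _ _) , Equivalence.from succ⇔ s))
    where
    succ⇔ : T ((suc (toℕ i) % L ℕ.≡ᵇ toℕ j) ∨ (suc (toℕ j) % L ℕ.≡ᵇ toℕ i)) ⇔
            (suc (toℕ i) % L ≡ toℕ j ⊎ suc (toℕ j) % L ≡ toℕ i)
    succ⇔ = ⇔-trans T-∨ (T-≡ᵇ {suc (toℕ i) % L} ⊎-⇔ T-≡ᵇ {suc (toℕ j) % L})
    distinct : (suc (toℕ i) % L ≡ toℕ j ⊎ suc (toℕ j) % L ≡ toℕ i) → toℕ i ≢ toℕ j
    distinct (inj₁ e) i≡j = suc-toℕ%≢toℕ i (trans e (sym i≡j))
    distinct (inj₂ e) i≡j = suc-toℕ%≢toℕ j (trans e i≡j)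

  cyclicSuccessor⇔ : {R : A → A → Set} (f : Fin L → A) →
    (∀ i j → suc (toℕ i) % L ≡ toℕ j → R (f i) (f j)) ⇔
    ((∀ i j → suc (toℕ i) ≡ toℕ j → R (f i) (f j)) × R (f (Fin.fromℕ (suc l))) (f zero))
  cyclicSuccessor⇔ {R = R} f = mk⇔ to from
    where
    Successor : (ℕ → ℕ) → Set
    Successor next = ∀ i j → next (toℕ i) ≡ toℕ j → R (f i) (f j)
    last%≡0 : suc (toℕ (Fin.fromℕ (suc l))) % L ≡ 0
    last%≡0 = trans (cong (λ n → suc n % L) (toℕ-fromℕ (suc l))) (n%n≡0 L)
    to : Successor (λ n → suc n % L) → Successor suc × R (f (Fin.fromℕ (suc l))) (f zero)
    to h = (λ i j e → h i j (trans (m<n⇒m%n≡m (subst (_< L) (sym e) (toℕ<n j))) e)) , h _ zero last%≡0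
    from : Successor suc × R (f (Fin.fromℕ (suc l))) (f zero) → Successor (λ n → suc n % L)
    from (h , r) i j e with suc-toℕ<⊎≡last i
    ... | inj₁ lt = h i j (trans (sym (m<n⇒m%n≡m lt)) e)
    ... | inj₂ i≡last
      rewrite toℕ-injective {i = i} (trans i≡last (sym (toℕ-fromℕ (suc l))))
            | toℕ-injective {i = j} {j = zero} (trans (sym e) last%≡0) = r

Proper-cycle⇔CyclicSmirnov : ∀ l {N} (κ : Fin (suc (suc l)) → Fin N) → Proper (cycle (suc (suc l))) κ ⇔ CyclicSmirnov (tabulate κ)
Proper-cycle⇔CyclicSmirnov l κ =
  ⇔-trans (Proper⇔oriented (cycle (suc (suc l))) _ (cycle-adj l) κ)
  (⇔-trans (cyclicSuccessor⇔ l {R = _≢_} κ)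
  (⇔-trans (mk⇔ (Linked-tabulate⁺ κ) (Linked-tabulate⁻ κ) ×-⇔ mk⇔ id id)
           (mk⇔ (uncurry (Linked-tabulate-∷ʳ⁺ κ)) (Linked-tabulate-∷ʳ⁻ κ))))

module WordCounting (N : ℕ) where

  open CycleInsertion (Fin._≟_ {N})

  Word : Set
  Word = List (Fin N)

  words : ℕ → List Word
  words zero    = [ [] ]
  words (suc k) = cartesianProductWith _∷_ (allFin N) (words k)

  ∈-words⁺ : ∀ {w k} → length w ≡ k → w ∈ words k
  ∈-words⁺ {[]}    {zero}  refl = here refl
  ∈-words⁺ {c ∷ w} {suc k} e    = ∈-cartesianProductWith⁺ _∷_ (∈-allFin c) (∈-words⁺ (ℕ.suc-injective e))

  ∈-words⁻ : ∀ {w} k → w ∈ words k → length w ≡ k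
  ∈-words⁻ zero    (here refl) = refl
  ∈-words⁻ (suc k) w∈ with ∈-cartesianProductWith⁻ _∷_ (allFin N) (words k) w∈
  ... | _ , _ , _ , w′∈ , refl = cong suc (∈-words⁻ k w′∈)

  words-unique : ∀ k → Unique (words k)
  words-unique zero    = All.[] AllPairs.∷ AllPairs.[]
  words-unique (suc k) = Unique.cartesianProductWith⁺ _∷_ ∷-injective (Unique.allFin⁺ N) (words-unique k)

  ∑-functions : ∀ v (f : Word → ℕ) → ∑[ κ ∈ functions v N ] f (tabulate κ) ≡ ∑ (words v) f
  ∑-functions zero    f = refl
  ∑-functions (suc v) f = begin
    ∑[ κ ∈ functions (suc v) N ] f (tabulate κ)
      ≡⟨ ∑-concatMap (λ c → map (c ◂_) (functions v N)) (allFin N) (f ∘ tabulate) ⟩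
    ∑[ c ∈ allFin N ] ∑[ κ ∈ map (c ◂_) (functions v N) ] f (tabulate κ)
      ≡⟨ ∑-cong (allFin N) (λ {c} _ → ∑-map (c ◂_) (functions v N) (f ∘ tabulate)) ⟩
    ∑[ c ∈ allFin N ] ∑[ κ ∈ functions v N ] f (c ∷ tabulate κ)
      ≡⟨ ∑-cong (allFin N) (λ {c} _ → ∑-functions v (f ∘ (c ∷_))) ⟩
    ∑[ c ∈ allFin N ] ∑[ w ∈ words v ] f (c ∷ w)
      ≡⟨ ∑-cartesianProductWith _∷_ (allFin N) (words v) f ⟨
    ∑ (words (suc v)) f ∎
    where open ≡-Reasoning

  ∑-words-++ : ∀ k l (f : Word → ℕ) → ∑[ u ∈ words k ] ∑[ w ∈ words l ] f (u ++ w) ≡ ∑ (words (k + l)) f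
  ∑-words-++ zero    l f = +-identityʳ _
  ∑-words-++ (suc k) l f = begin
    ∑[ u ∈ words (suc k) ] ∑[ w ∈ words l ] f (u ++ w)
      ≡⟨ ∑-cartesianProductWith _∷_ (allFin N) (words k) _ ⟩
    ∑[ c ∈ allFin N ] ∑[ u ∈ words k ] ∑[ w ∈ words l ] f (c ∷ u ++ w)
      ≡⟨ ∑-cong (allFin N) (λ {c} _ → ∑-words-++ k l (f ∘ (c ∷_))) ⟩
    ∑[ c ∈ allFin N ] ∑[ w ∈ words (k + l) ] f (c ∷ w)
      ≡⟨ ∑-cartesianProductWith _∷_ (allFin N) (words (k + l)) f ⟨
    ∑ (words (suc k + l)) f ∎
    where open ≡-Reasoning

  content : Word → Fin N → ℕ
  content w c = length (filter (Fin._≟ c) w)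

  content-++ : ∀ u w c → content (u ++ w) c ≡ content u c + content w c
  content-++ u w c = trans (cong length (filter-++ (Fin._≟ c) u w)) (length-++ (filter (Fin._≟ c) u))

  content-↭ : ∀ {u w} → u ↭ w → content u ≗ content w
  content-↭ u↭w c = ↭.↭-length (↭.filter-↭ (Fin._≟ c) u↭w)

  colourCount≡content : ∀ {v} (κ : Fin v → Fin N) → colourCount κ ≗ content (tabulate κ)
  colourCount≡content {v} κ c = begin
    length (filter (λ i → κ i Fin.≟ c) (allFin v)) ≡⟨ length-filter≡∑𝟙 _ (allFin v) ⟩
    ∑[ i ∈ allFin v ] 𝟙 (κ i Fin.≟ c)             ≡⟨ ∑-map κ (allFin v) (λ x → 𝟙 (x Fin.≟ c)) ⟨
    ∑[ x ∈ map κ (allFin v) ] 𝟙 (x Fin.≟ c)       ≡⟨ cong (λ xs → ∑ xs (λ x → 𝟙 (x Fin.≟ c))) (map-tabulate id κ) ⟩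
    ∑[ x ∈ tabulate κ ] 𝟙 (x Fin.≟ c)             ≡⟨ length-filter≡∑𝟙 _ (tabulate κ) ⟨
    content (tabulate κ) c                         ∎
    where open ≡-Reasoning

  wordCount : {P : Word → Set} → Decidable P → ℕ → (Fin N → ℕ) → ℕ
  wordCount P? k α = ∑[ w ∈ words k ] (𝟙 (P? w) * 𝟙 (content w ≗? α))

  X≡wordCount : (G : Graph) {P : Word → Set} (P? : Decidable P) → (∀ κ → Proper G κ ⇔ P (tabulate κ)) →
                ∀ α → X G N α ≡ fromℕ (wordCount P? (size G) α)
  X≡wordCount G P? proper⇔ α = cong fromℕ (begin
    length (filter (λ κ → proper? G κ ×-dec hasExponent? κ α) (functions (size G) N))
      ≡⟨ length-filter≡∑𝟙 _ (functions (size G) N) ⟩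
    ∑[ κ ∈ functions (size G) N ] 𝟙 (proper? G κ ×-dec hasExponent? κ α)
      ≡⟨ ∑-cong (functions (size G) N) (λ {κ} _ → colouring≡word κ) ⟩
    ∑[ κ ∈ functions (size G) N ] (𝟙 (P? (tabulate κ)) * 𝟙 (content (tabulate κ) ≗? α))
      ≡⟨ ∑-functions (size G) (λ w → 𝟙 (P? w) * 𝟙 (content w ≗? α)) ⟩
    wordCount P? (size G) α ∎)
    where
    open ≡-Reasoning
    exponent⇔ : ∀ κ → HasExponent κ α ⇔ content (tabulate κ) ≗ α
    exponent⇔ κ = mk⇔ (λ h c → trans (sym (colourCount≡content κ c)) (h c)) (λ h c → trans (colourCount≡content κ c) (h c))
    colouring≡word : ∀ κ → 𝟙 (proper? G κ ×-dec hasExponent? κ α) ≡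
                           𝟙 (P? (tabulate κ)) * 𝟙 (content (tabulate κ) ≗? α)
    colouring≡word κ = trans (𝟙-cong _ (P? (tabulate κ) ×-dec content (tabulate κ) ≗? α) (proper⇔ κ ×-⇔ exponent⇔ κ))
                             (𝟙-× (P? (tabulate κ)) (content (tabulate κ) ≗? α))

  pathCount : ℕ → (Fin N → ℕ) → ℕ
  pathCount = wordCount (smirnov? Fin._≟_)

  cycleCount : ℕ → (Fin N → ℕ) → ℕ
  cycleCount = wordCount (cyclicSmirnov? Fin._≟_)

  X-path : ∀ k α → X (path k) N α ≡ fromℕ (pathCount k α)
  X-path k = X≡wordCount (path k) (smirnov? Fin._≟_) Proper-path⇔Smirnov

  X-cycle : ∀ {L} → 2 ≤ L → ∀ α → X (cycle L) N α ≡ fromℕ (cycleCount L α)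
  X-cycle {suc (suc l)} (s≤s (s≤s z≤n)) = X≡wordCount (cycle (2 + l)) (cyclicSmirnov? Fin._≟_) (Proper-cycle⇔CyclicSmirnov l)

  X-path·X-cycle : ∀ k {L} → 2 ≤ L → ∀ α →
    (X (path k) · X (cycle L)) N α ≡ fromℕ (∑[ β ∈ below N α ] (pathCount k β * cycleCount L (λ i → α i ∸ β i)))
  X-path·X-cycle k 2≤L α = sumℚ-fromℕ (below N α) λ {β} _ →
    trans (cong₂ ℚ._*_ (X-path k β) (X-cycle 2≤L (λ i → α i ∸ β i))) (fromℕ-* (pathCount k β) _)

  wordCount-convolution : {P Q : Word → Set} (P? : Decidable P) (Q? : Decidable Q) (k l : ℕ) (α : Fin N → ℕ) →
    ∑[ β ∈ below N α ] (wordCount P? k β * wordCount Q? l (λ i → α i ∸ β i)) ≡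
    ∑[ p ∈ cartesianProduct (words k) (words l) ] 𝟙 ((P? (proj₁ p) ×-dec Q? (proj₂ p)) ×-dec content (proj₁ p ++ proj₂ p) ≗? α)
  wordCount-convolution P? Q? k l α = begin
    ∑[ β ∈ below N α ] (wordCount P? k β * wordCount Q? l (λ i → α i ∸ β i))
      ≡⟨ ∑-cong (below N α) (λ {β} _ → ∑*∑ (words k) (words l) (a β) (b β)) ⟩
    ∑[ β ∈ below N α ] ∑[ p ∈ uw ] (a β (proj₁ p) * b β (proj₂ p))
      ≡⟨ ∑-swap (below N α) uw (λ β p → a β (proj₁ p) * b β (proj₂ p)) ⟩
    ∑[ p ∈ uw ] ∑[ β ∈ below N α ] (a β (proj₁ p) * b β (proj₂ p))
      ≡⟨ ∑-cong uw (λ {p} _ → sift p) ⟩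
    ∑[ p ∈ uw ] 𝟙 ((P? (proj₁ p) ×-dec Q? (proj₂ p)) ×-dec content (proj₁ p ++ proj₂ p) ≗? α) ∎
    where
    open ≡-Reasoning
    uw : List (Word × Word)
    uw = cartesianProduct (words k) (words l)
    a : (Fin N → ℕ) → Word → ℕ
    a β u = 𝟙 (P? u) * 𝟙 (content u ≗? β)
    b : (Fin N → ℕ) → Word → ℕ
    b β w = 𝟙 (Q? w) * 𝟙 (content w ≗? (λ i → α i ∸ β i))
    sift : ∀ p → ∑[ β ∈ below N α ] (a β (proj₁ p) * b β (proj₂ p)) ≡
                 𝟙 ((P? (proj₁ p) ×-dec Q? (proj₂ p)) ×-dec content (proj₁ p ++ proj₂ p) ≗? α)
    sift (u , w) = begin
      ∑[ β ∈ below N α ] (a β u * b β w)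
        ≡⟨ ∑-cong (below N α) (λ _ → ℕ.[m*n]*[o*p]≡[m*o]*[n*p] (𝟙 (P? u)) _ (𝟙 (Q? w)) _) ⟩
      ∑[ β ∈ below N α ] (𝟙 (P? u) * 𝟙 (Q? w) * (𝟙 (content u ≗? β) * 𝟙 (content w ≗? (λ i → α i ∸ β i))))
        ≡⟨ ∑-*ˡ (𝟙 (P? u) * 𝟙 (Q? w)) (below N α) _ ⟩
      𝟙 (P? u) * 𝟙 (Q? w) * ∑[ β ∈ below N α ] (𝟙 (content u ≗? β) * 𝟙 (content w ≗? (λ i → α i ∸ β i)))
        ≡⟨ cong (𝟙 (P? u) * 𝟙 (Q? w) *_) (∑-below-𝟙 N α (content u) (content w)) ⟩
      𝟙 (P? u) * 𝟙 (Q? w) * 𝟙 ((λ i → content u i + content w i) ≗? α)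
        ≡⟨ cong (𝟙 (P? u) * 𝟙 (Q? w) *_) (𝟙-cong _ (content (u ++ w) ≗? α) (mk⇔
             (λ h c → trans (content-++ u w c) (h c)) (λ h c → trans (sym (content-++ u w c)) (h c)))) ⟩
      𝟙 (P? u) * 𝟙 (Q? w) * 𝟙 (content (u ++ w) ≗? α)
        ≡⟨ cong (_* 𝟙 (content (u ++ w) ≗? α)) (𝟙-× (P? u) (Q? w)) ⟨
      𝟙 (P? u ×-dec Q? w) * 𝟙 (content (u ++ w) ≗? α)
        ≡⟨ 𝟙-× (P? u ×-dec Q? w) (content (u ++ w) ≗? α) ⟨
      𝟙 ((P? u ×-dec Q? w) ×-dec content (u ++ w) ≗? α) ∎

  module _ (m : ℕ) where

    block : ℕ → List (Word × Word)
    block k = cartesianProduct (words k) (words (2 + m ∸ k))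

    pairs : List (Word × Word)
    pairs = concatMap block (upTo (suc m))

    ∈-pairs⁻ : ∀ {p} → p ∈ pairs → length (proj₁ p ++ proj₂ p) ≡ 2 + m × 2 ≤ length (proj₂ p)
    ∈-pairs⁻ {s , t} p∈ with find (∈-concatMap⁻ block p∈)
    ... | k , k∈ , st∈ with ∈-cartesianProduct⁻ (words k) (words (2 + m ∸ k)) st∈
    ...   | s∈ , t∈ rewrite length-++ s {t} | ∈-words⁻ k s∈ | ∈-words⁻ (2 + m ∸ k) t∈ =
      ℕ.m+[n∸m]≡n (ℕ.m≤n⇒m≤o+n 2 k≤m) , 2≤2+m∸k k≤m
      where
      k≤m : k ≤ m
      k≤m = ≤-pred (∈-upTo⁻ k∈)

    ∈-pairs⁺ : ∀ {p} → length (proj₁ p ++ proj₂ p) ≡ 2 + m → 2 ≤ length (proj₂ p) → p ∈ pairs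
    ∈-pairs⁺ {s , t} |st|≡ 2≤|t| =
      ∈-concatMap⁺ block (lose (∈-upTo⁺ (s≤s |s|≤m)) (∈-cartesianProduct⁺ (∈-words⁺ refl) (∈-words⁺ |t|≡)))
      where
      |s|+|t|≡ : length s + length t ≡ 2 + m
      |s|+|t|≡ = trans (sym (length-++ s)) |st|≡
      |s|≤m : length s ≤ m
      |s|≤m = ℕ.m+n≤o⇒m≤o∸n (length s) (subst (length s + 2 ≤_) |s|+|t|≡ (ℕ.+-monoʳ-≤ (length s) 2≤|t|))
      |t|≡ : length t ≡ 2 + m ∸ length s
      |t|≡ = sym (trans (cong (_∸ length s) (sym |s|+|t|≡)) (ℕ.m+n∸m≡n (length s) (length t)))

    pairs-unique : Unique pairs
    pairs-unique = Unique.concat⁺ (All.map⁺ (All.universal block-unique (upTo (suc m))))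
                                  (AllPairs.map⁺ (AllPairs.map disjoint (Unique.upTo⁺ (suc m))))
      where
      block-unique : ∀ k → Unique (block k)
      block-unique k = Unique.cartesianProduct⁺ (words-unique k) (words-unique (2 + m ∸ k))
      disjoint : ∀ {k k′} → k ≢ k′ → Disjoint (block k) (block k′)
      disjoint {k} {k′} k≢k′ (p∈ , p∈′) =
        k≢k′ (trans (sym (∈-words⁻ k (proj₁ (∈-cartesianProduct⁻ _ _ p∈))))
                    (∈-words⁻ k′ (proj₁ (∈-cartesianProduct⁻ _ _ p∈′))))

    module _ (α : Fin N → ℕ) where

      private
        WithContent : (Word × Word → Set) → Word × Word → Set
        WithContent P p = P p × content (uncurry _++_ p) ≗ α

        pathCycle? : Decidable (WithContent PathCycle)
        pathCycle? p = (smirnov? Fin._≟_ (proj₁ p) ×-dec cyclicSmirnov? Fin._≟_ (proj₂ p)) ×-dec content (uncurry _++_ p) ≗? α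

        concatSmirnov? : Decidable (WithContent (Smirnov ∘ uncurry _++_))
        concatSmirnov? p = smirnov? Fin._≟_ (uncurry _++_ p) ×-dec content (uncurry _++_ p) ≗? α

      insertCycle-pairs : ∀ {p} → p ∈ pairs → WithContent PathCycle p →
        insertCycle p ∈ pairs × WithContent (Smirnov ∘ uncurry _++_) (insertCycle p) × extractCycle (insertCycle p) ≡ p
      insertCycle-pairs {p} p∈ (pc , c≗α) =
        let (σ , 2≤) , round = insertCycle-correct p pc ; ↭p = insertCycle-↭ p in
        ∈-pairs⁺ (trans (↭.↭-length ↭p) (proj₁ (∈-pairs⁻ p∈))) 2≤ ,
        (σ , λ c → trans (content-↭ ↭p c) (c≗α c)) , round

      extractCycle-pairs : ∀ {p} → p ∈ pairs → WithContent (Smirnov ∘ uncurry _++_) p →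
        extractCycle p ∈ pairs × WithContent PathCycle (extractCycle p) × insertCycle (extractCycle p) ≡ p
      extractCycle-pairs {p} p∈ (σ , c≗α) =
        let |p|≡ , 2≤ = ∈-pairs⁻ p∈ ; pc , round = extractCycle-correct p (σ , 2≤) ; ↭p = extractCycle-↭ p (σ , 2≤) in
        ∈-pairs⁺ (trans (↭.↭-length ↭p) |p|≡) (CyclicSmirnov⇒2≤length _ (proj₂ pc)) ,
        (pc , λ c → trans (content-↭ ↭p c) (c≗α c)) , round

      block-count : ∀ {k} → k ≤ m → ∑[ p ∈ block k ] 𝟙 (concatSmirnov? p) ≡ pathCount (2 + m) α
      block-count {k} k≤m = begin
        ∑[ p ∈ block k ] 𝟙 (concatSmirnov? p)
          ≡⟨ ∑-cartesianProductWith _,_ (words k) (words (2 + m ∸ k)) (𝟙 ∘ concatSmirnov?) ⟩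
        ∑[ u ∈ words k ] ∑[ w ∈ words (2 + m ∸ k) ] 𝟙 (concatSmirnov? (u , w))
          ≡⟨ ∑-words-++ k (2 + m ∸ k) f ⟩
        ∑[ w ∈ words (k + (2 + m ∸ k)) ] f w
          ≡⟨ cong (λ n → ∑ (words n) f) (ℕ.m+[n∸m]≡n (ℕ.m≤n⇒m≤o+n 2 k≤m)) ⟩
        ∑[ w ∈ words (2 + m) ] f w
          ≡⟨ ∑-cong (words (2 + m)) (λ {w} _ → 𝟙-× (smirnov? Fin._≟_ w) (content w ≗? α)) ⟩
        pathCount (2 + m) α ∎
        where
        open ≡-Reasoning
        f : Word → ℕ
        f w = 𝟙 (smirnov? Fin._≟_ w ×-dec content w ≗? α)

      path-cycle-count :
        ∑[ k ∈ upTo (suc m) ] ∑[ β ∈ below N α ] (pathCount k β * cycleCount (2 + m ∸ k) (λ i → α i ∸ β i))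
        ≡ suc m * pathCount (2 + m) α
      path-cycle-count = begin
        ∑[ k ∈ upTo (suc m) ] ∑[ β ∈ below N α ] (pathCount k β * cycleCount (2 + m ∸ k) (λ i → α i ∸ β i))
          ≡⟨ ∑-cong (upTo (suc m)) (λ {k} _ →
               wordCount-convolution (smirnov? Fin._≟_) (cyclicSmirnov? Fin._≟_) k (2 + m ∸ k) α) ⟩
        ∑[ k ∈ upTo (suc m) ] ∑[ p ∈ block k ] 𝟙 (pathCycle? p)
          ≡⟨ ∑-concatMap block (upTo (suc m)) (𝟙 ∘ pathCycle?) ⟨
        ∑[ p ∈ pairs ] 𝟙 (pathCycle? p)
          ≡⟨ ∑𝟙-bijection pathCycle? concatSmirnov? pairs-unique insertCycle extractCycle insertCycle-pairs extractCycle-pairs ⟩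
        ∑[ p ∈ pairs ] 𝟙 (concatSmirnov? p)
          ≡⟨ ∑-concatMap block (upTo (suc m)) (𝟙 ∘ concatSmirnov?) ⟩
        ∑[ k ∈ upTo (suc m) ] ∑[ p ∈ block k ] 𝟙 (concatSmirnov? p)
          ≡⟨ ∑-cong (upTo (suc m)) (λ k∈ → block-count (≤-pred (∈-upTo⁻ k∈))) ⟩
        ∑[ k ∈ upTo (suc m) ] pathCount (2 + m) α
          ≡⟨ ∑-const (upTo (suc m)) (pathCount (2 + m) α) ⟩
        length (upTo (suc m)) * pathCount (2 + m) α
          ≡⟨ cong (_* pathCount (2 + m) α) (length-upTo (suc m)) ⟩
        suc m * pathCount (2 + m) α ∎
        where open ≡-Reasoning

corollary2p12 : (m : ℕ) →
    let n = 2 + m in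
    ((+ 1 / suc m) ⋆ (Σ[k≤ m ] (λ k → X (path k) · X (cycle (n ∸ k))))) ≈ X (path n)
corollary2p12 m N α = begin
  (+ 1 / suc m) ℚ.* sumℚ (map (λ k → (X (path k) · X (cycle (2 + m ∸ k))) N α) (upTo (suc m)))
    ≡⟨ cong ((+ 1 / suc m) ℚ.*_) (sumℚ-fromℕ (upTo (suc m)) {f = term} λ {k} k∈ →
         X-path·X-cycle k (2≤2+m∸k (≤-pred (∈-upTo⁻ k∈))) α) ⟩
  (+ 1 / suc m) ℚ.* fromℕ (∑ (upTo (suc m)) term)
    ≡⟨ cong (λ c → (+ 1 / suc m) ℚ.* fromℕ c) (path-cycle-count m α) ⟩
  (+ 1 / suc m) ℚ.* fromℕ (suc m * pathCount (2 + m) α)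
    ≡⟨ 1/suc-*-fromℕ m (pathCount (2 + m) α) ⟩
  fromℕ (pathCount (2 + m) α)
    ≡⟨ X-path (2 + m) α ⟨
  X (path (2 + m)) N α ∎
  where
  open ≡-Reasoning
  open WordCounting N
  term : ℕ → ℕ
  term k = ∑[ β ∈ below N α ] (pathCount k β * cycleCount (2 + m ∸ k) (λ i → α i ∸ β i))
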